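{- Let $n$ be a positive integer. The total number of non-root records, summed over all rooted trees with vertex set $[n]$, equals $\gamma_n$, where $\gamma_n$ is $\frac1n$ times the sum, over all rooted trees with vertex set $[n]$, of the total height of the tree.
   Context: All trees are labeled; a rooted tree on $[n]$ has vertex set $[n]=\{1,\dots,n\}$ and a distinguished root. A node $v$ is a record if its label is the largest on the path from $v$ to the root (inclusive); the root is always a record. The height of a node is the number of edges on its path to the root, and the total height of a tree is the sum of the heights of its nodes. The sequence $(\gamma_n)$ is the "normalized total height of all nodes in all rooted trees with $n$ labeled nodes" (OEIS A000435). -}

module Defs where

open import Data.Nat using (ℕ; zero; suc; _+_; _≤ᵇ_)
open import Data.Fin using (Fin; toℕ; _≟_)
open import Data.Bool using (Bool; true; false; _∧_; not; if_then_else_)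
open import Data.List using (List; []; _∷_; map; concatMap; allFin; upTo; length; filterᵇ)
open import Data.Bool.ListAction using (all; any)
open import Data.Nat.ListAction using (sum)
open import Data.Vec using (Vec; []; _∷_; lookup)
open import Relation.Nullary.Decidable using (⌊_⌋)

-- A rooted tree on [n] (vertices encoded as Fin n, label i ↦ i+1, which
-- preserves the order of labels) is encoded by its parent map
-- p : Vec (Fin n) n, where the root is its own parent.
ParentMap : ℕ → Set
ParentMap n = Vec (Fin n) n

iter : ∀ {n} → ParentMap n → ℕ → Fin n → Fin n
iter p zero    v = v
iter p (suc k) v = lookup p (iter p k v)

_==_ : ∀ {n} → Fin n → Fin n → Bool
a == b = ⌊ a ≟ b ⌋

-- p is (the parent map of) a rooted tree: there is a vertex r (the root)
-- with p r = r such that every vertex reaches r after n parent steps.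
-- (This forces the functional graph to be a tree rooted at r.)
isRootedTree : ∀ {n} → ParentMap n → Bool
isRootedTree {n} p =
  any (λ r → (lookup p r == r) ∧ all (λ v → iter p n v == r) (allFin n)) (allFin n)

allVecs : (n k : ℕ) → List (Vec (Fin n) k)
allVecs n zero    = [] ∷ []
allVecs n (suc k) = concatMap (λ x → map (x ∷_) (allVecs n k)) (allFin n)

rootedTrees : (n : ℕ) → List (ParentMap n)
rootedTrees n = filterᵇ isRootedTree (allVecs n n)

rootFrom : ∀ {n} → ParentMap n → Fin n → Fin n
rootFrom {n} p v = iter p n v

height : ∀ {n} → ParentMap n → Fin n → ℕ
height {n} p v = length (filterᵇ (λ i → not (iter p i v == rootFrom p v)) (upTo n))

totalHeight : ∀ {n} → ParentMap n → ℕ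
totalHeight {n} p = sum (map (height p) (allFin n))

-- v is a record: its label is the largest on the path from v to the root
-- (the path is iter p 0 v, …, iter p (height v) v; further iterates stay at the root)
isRecord : ∀ {n} → ParentMap n → Fin n → Bool
isRecord {n} p v = all (λ i → toℕ (iter p i v) ≤ᵇ toℕ v) (upTo (suc n))

isNonRootRecord : ∀ {n} → ParentMap n → Fin n → Bool
isNonRootRecord p v = isRecord p v ∧ not (v == rootFrom p v)

nonRootRecords : ∀ {n} → ParentMap n → ℕ
nonRootRecords {n} p = length (filterᵇ (isNonRootRecord p) (allFin n))

{-# OPTIONS --safe #-}

-- Both sides are counted through connected maps g on [n], whose functional graph is a single cycle with
-- trees hanging from it. Redirecting the root r of a rooted tree p to a vertex w gives such a map, whose
-- cycle is the path from w up to r; cutting g open just before a cyclic vertex c, and redirecting the new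
-- root back to c, undoes this. Choosing w suitably gives three bijections:
--   trees with a record v                ↔  connected maps                  (w = v = the largest cyclic vertex)
--   trees with a vertex v                ↔  maps with a cyclic vertex c     (w = v = c)
--   trees with v and a step i < height v ↔  maps with an acyclic vertex c   (w = the (i+1)-st ancestor of v, c = v)
-- Over all trees let T be their number, R their number of non-root records and H their total height, and
-- let C be the number of connected maps. Then R + T = C and n·C = n·T + H, hence n·R = H.

module Submission where

open import Defs
open import Data.Bool using (Bool; true; false; T; _∧_; not)
open import Data.Bool.ListAction using (all; any)
open import Data.Bool.Properties using (T-irrelevant; T-∧; T-≡; ∧-zeroʳ)
open import Data.Empty using (⊥-elim)
open import Data.Fin as Fin using (Fin; toℕ)
import Data.Fin.Properties as Fin
open import Data.List using (List; []; _∷_; _++_; map; concatMap; cartesianProduct; length; filterᵇ; allFin; upTo; applyUpTo; tabulate)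
open import Data.List.Properties using (map-tabulate; map-applyUpTo; length-tabulate)
open import Data.List.Membership.Propositional using (_∈_; lose)
open import Data.List.Membership.Propositional.Properties using (∈-allFin; ∈-upTo⁺)
open import Data.List.Relation.Unary.All as All using ()
open import Data.List.Relation.Unary.All.Properties using (all⁺; all⁻)
open import Data.List.Relation.Unary.Any using (here; there; satisfied)
open import Data.List.Relation.Unary.Any.Properties using (any⁺; any⁻)
import Data.Nat as ℕ
open import Data.Nat using (ℕ; zero; suc; _+_; _*_; _∸_; _<_; _≤_; _≤?_; _≤ᵇ_; z≤n; s≤s)
open import Data.Nat.Induction using (<-rec)
open import Data.Nat.ListAction using (sum)
open import Data.Nat.Properties hiding (_≟_)
open import Algebra.Properties.CommutativeSemigroup +-commutativeSemigroup using (interchange)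
open import Data.Product using (Σ; ∃; _×_; _,_; proj₁; proj₂; uncurry)
import Data.Product.Properties as ×
open import Data.Sum using (_⊎_; inj₁; inj₂)
open import Data.Unit using (tt)
open import Data.Vec using (Vec; []; _∷_; lookup; _[_]≔_)
import Data.Vec.Properties as Vec
open import Function using (id; _∘_; case_of_; _↔_; Inverse; mk↔ₛ′; _⇔_; mk⇔; Equivalence)
open import Relation.Binary.Definitions using (DecidableEquality; tri<; tri≈; tri>)
open import Relation.Binary.PropositionalEquality
open import Relation.Nullary.Decidable using (Dec; yes; no; does; T?; _×-dec_; _⊎-dec_; does-⇔; dec-false; toWitness; fromWitness)
open import Relation.Nullary.Negation using (¬_)
import Relation.Unary as U

private variable A B : Set

𝟙 : Bool → ℕ
𝟙 true  = 1
𝟙 false = 0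

∑ : List A → (A → ℕ) → ℕ
∑ xs f = sum (map f xs)

syntax ∑ xs (λ x → e) = ∑[ x ∈ xs ] e

𝟙-∧ : ∀ a b → 𝟙 (a ∧ b) ≡ 𝟙 a * 𝟙 b
𝟙-∧ true  b = sym (*-identityˡ (𝟙 b))
𝟙-∧ false b = refl

𝟙-∧-not : ∀ a b → 𝟙 (a ∧ not b) + 𝟙 (a ∧ b) ≡ 𝟙 a
𝟙-∧-not true  true  = refl
𝟙-∧-not true  false = refl
𝟙-∧-not false b     = refl

∑-cong : (xs : List A) {f g : A → ℕ} → (∀ x → f x ≡ g x) → ∑ xs f ≡ ∑ xs g
∑-cong []       eq = refl
∑-cong (x ∷ xs) eq = cong₂ _+_ (eq x) (∑-cong xs eq)

∑-zero : (xs : List A) → ∑[ x ∈ xs ] 0 ≡ 0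
∑-zero []       = refl
∑-zero (x ∷ xs) = ∑-zero xs

∑-+ : (xs : List A) (f g : A → ℕ) → ∑[ x ∈ xs ] (f x + g x) ≡ ∑ xs f + ∑ xs g
∑-+ []       f g = refl
∑-+ (x ∷ xs) f g = trans (cong (f x + g x +_) (∑-+ xs f g)) (interchange (f x) (g x) (∑ xs f) (∑ xs g))

∑-*ˡ : (xs : List A) (c : ℕ) (f : A → ℕ) → ∑[ x ∈ xs ] (c * f x) ≡ c * ∑ xs f
∑-*ˡ []       c f = sym (*-zeroʳ c)
∑-*ˡ (x ∷ xs) c f = trans (cong (c * f x +_) (∑-*ˡ xs c f)) (sym (*-distribˡ-+ c (f x) (∑ xs f)))

∑-const : (xs : List A) (c : ℕ) → ∑[ x ∈ xs ] c ≡ c * length xs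
∑-const []       c = sym (*-zeroʳ c)
∑-const (x ∷ xs) c = trans (cong (c +_) (∑-const xs c)) (sym (*-suc c (length xs)))

∑-swap : (xs : List A) (ys : List B) (f : A → B → ℕ) →
         ∑[ x ∈ xs ] ∑[ y ∈ ys ] f x y ≡ ∑[ y ∈ ys ] ∑[ x ∈ xs ] f x y
∑-swap []       ys f = sym (∑-zero ys)
∑-swap (x ∷ xs) ys f =
  trans (cong (∑ ys (f x) +_) (∑-swap xs ys f)) (sym (∑-+ ys (f x) (λ y → ∑[ x ∈ xs ] f x y)))

∑-++ : (xs ys : List A) (f : A → ℕ) → ∑ (xs ++ ys) f ≡ ∑ xs f + ∑ ys f
∑-++ []       ys f = refl
∑-++ (x ∷ xs) ys f = trans (cong (f x +_) (∑-++ xs ys f)) (sym (+-assoc (f x) (∑ xs f) (∑ ys f)))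

∑-map : (xs : List A) (g : A → B) (f : B → ℕ) → ∑ (map g xs) f ≡ ∑[ x ∈ xs ] f (g x)
∑-map []       g f = refl
∑-map (x ∷ xs) g f = cong (f (g x) +_) (∑-map xs g f)

∑-concatMap : (xs : List A) (g : A → List B) (f : B → ℕ) →
              ∑ (concatMap g xs) f ≡ ∑[ x ∈ xs ] ∑ (g x) f
∑-concatMap []       g f = refl
∑-concatMap (x ∷ xs) g f = trans (∑-++ (g x) (concatMap g xs) f) (cong (∑ (g x) f +_) (∑-concatMap xs g f))

∑-cartesianProduct : (xs : List A) (ys : List B) (f : A × B → ℕ) →
                     ∑ (cartesianProduct xs ys) f ≡ ∑[ x ∈ xs ] ∑[ y ∈ ys ] f (x , y)
∑-cartesianProduct []       ys f = refl
∑-cartesianProduct (x ∷ xs) ys f = begin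
  ∑ (map (x ,_) ys ++ cartesianProduct xs ys) f
    ≡⟨ ∑-++ (map (x ,_) ys) (cartesianProduct xs ys) f ⟩
  ∑ (map (x ,_) ys) f + ∑ (cartesianProduct xs ys) f
    ≡⟨ cong₂ _+_ (∑-map ys (x ,_) f) (∑-cartesianProduct xs ys f) ⟩
  ∑[ y ∈ ys ] f (x , y) + ∑[ x ∈ xs ] ∑[ y ∈ ys ] f (x , y) ∎
  where open ≡-Reasoning

∑-filterᵇ : (P : A → Bool) (xs : List A) (f : A → ℕ) →
            ∑ (filterᵇ P xs) f ≡ ∑[ x ∈ xs ] (𝟙 (P x) * f x)
∑-filterᵇ P []       f = refl
∑-filterᵇ P (x ∷ xs) f with P x
... | true  = cong₂ _+_ (sym (+-identityʳ (f x))) (∑-filterᵇ P xs f)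
... | false = ∑-filterᵇ P xs f

length-filterᵇ : (P : A → Bool) (xs : List A) → length (filterᵇ P xs) ≡ ∑[ x ∈ xs ] 𝟙 (P x)
length-filterᵇ P []       = refl
length-filterᵇ P (x ∷ xs) with P x
... | true  = cong suc (length-filterᵇ P xs)
... | false = length-filterᵇ P xs

𝟙-*-cong : ∀ b {x y} → (T b → x ≡ y) → 𝟙 b * x ≡ 𝟙 b * y
𝟙-*-cong true  eq = cong (1 *_) (eq tt)
𝟙-*-cong false _  = refl

∑-*-∑ : (xs : List A) (ys : List B) (f : A → ℕ) (g : B → ℕ) →
        ∑[ x ∈ xs ] ∑[ y ∈ ys ] (f x * g y) ≡ ∑ xs f * ∑ ys g
∑-*-∑ []       ys f g = refl
∑-*-∑ (x ∷ xs) ys f g =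
  trans (cong₂ _+_ (∑-*ˡ ys (f x) g) (∑-*-∑ xs ys f g)) (sym (*-distribʳ-+ (∑ ys g) (f x) (∑ xs f)))

∑-guarded : (xs : List A) (ys : List B) (a : A → Bool) (b : A → B → Bool) →
            ∑[ z ∈ cartesianProduct xs ys ] 𝟙 (a (proj₁ z) ∧ b (proj₁ z) (proj₂ z)) ≡
            ∑[ x ∈ xs ] (𝟙 (a x) * ∑[ y ∈ ys ] 𝟙 (b x y))
∑-guarded xs ys a b = trans (∑-cartesianProduct xs ys _)
  (∑-cong xs λ x → trans (∑-cong ys λ y → 𝟙-∧ (a x) (b x y)) (∑-*ˡ ys (𝟙 (a x)) (𝟙 ∘ b x)))

-- Counting through a bijection

T-not⁺ : ∀ {b} → ¬ T b → T (not b)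
T-not⁺ {true}  ¬b = ¬b tt
T-not⁺ {false} _  = tt

T-not⁻ : ∀ {b} → T (not b) → ¬ T b
T-not⁻ {true} ()

≡-subtype : {P : A → Bool} {u v : ∃ (T ∘ P)} → proj₁ u ≡ proj₁ v → u ≡ v
≡-subtype {u = x , px} {v = .x , qx} refl = cong (x ,_) (T-irrelevant px qx)

OccursOnce : DecidableEquality A → List A → A → Set
OccursOnce _≟_ xs a = ∑[ x ∈ xs ] 𝟙 (does (x ≟ a)) ≡ 1

-- Both sides count the pairs (x , y) with y the image of x (hits x y).
count-↔ : (_≟ᴬ_ : DecidableEquality A) (_≟ᴮ_ : DecidableEquality B) {P : A → Bool} {Q : B → Bool}
          (xs : List A) (ys : List B) → ∃ (T ∘ P) ↔ ∃ (T ∘ Q) →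
          (∀ a → T (P a) → OccursOnce _≟ᴬ_ xs a) → (∀ b → T (Q b) → OccursOnce _≟ᴮ_ ys b) →
          ∑[ x ∈ xs ] 𝟙 (P x) ≡ ∑[ y ∈ ys ] 𝟙 (Q y)
count-↔ {A} {B} _≟ᴬ_ _≟ᴮ_ {P} {Q} xs ys P↔Q xs-once ys-once = begin
    ∑[ x ∈ xs ] 𝟙 (P x)              ≡⟨ ∑-cong xs (λ x → sym (row x (T? (P x)))) ⟩
    ∑[ x ∈ xs ] ∑[ y ∈ ys ] hits x y ≡⟨ ∑-swap xs ys hits ⟩
    ∑[ y ∈ ys ] ∑[ x ∈ xs ] hits x y ≡⟨ ∑-cong ys (λ y → column y (T? (Q y))) ⟩
    ∑[ y ∈ ys ] 𝟙 (Q y)              ∎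
  where
  open ≡-Reasoning
  open Inverse P↔Q using (strictlyInverseˡ; strictlyInverseʳ) renaming (to to f; from to f⁻¹)

  hitsBy : ∀ x → Dec (T (P x)) → B → ℕ
  hitsBy x (yes px) y = 𝟙 (does (y ≟ᴮ proj₁ (f (x , px))))
  hitsBy x (no _)   y = 0

  hits : A → B → ℕ
  hits x = hitsBy x (T? (P x))

  row : ∀ x (px? : Dec (T (P x))) → ∑ ys (hitsBy x px?) ≡ 𝟙 (does px?)
  row x (yes px) = ys-once _ (proj₂ (f (x , px)))
  row x (no _)   = ∑-zero ys

  image⇔preimage : ∀ {x y} (px : T (P x)) (qy : T (Q y)) →
                        (y ≡ proj₁ (f (x , px))) ⇔ (x ≡ proj₁ (f⁻¹ (y , qy)))
  image⇔preimage {x} {y} px qy = mk⇔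
    (λ y≡ → cong proj₁ (sym (trans (cong f⁻¹ (≡-subtype y≡)) (strictlyInverseʳ (x , px)))))
    (λ x≡ → cong proj₁ (sym (trans (cong f (≡-subtype x≡)) (strictlyInverseˡ (y , qy)))))

  hitsBy-from : ∀ {y} (qy : T (Q y)) x (px? : Dec (T (P x))) →
                hitsBy x px? y ≡ 𝟙 (does (x ≟ᴬ proj₁ (f⁻¹ (y , qy))))
  hitsBy-from qy x (yes px) = cong 𝟙 (does-⇔ (image⇔preimage px qy) (_ ≟ᴮ _) (x ≟ᴬ _))
  hitsBy-from qy x (no ¬px) =
    cong 𝟙 (sym (dec-false (x ≟ᴬ _) λ x≡ → ¬px (subst (T ∘ P) (sym x≡) (proj₂ (f⁻¹ _)))))

  hitsBy-none : ∀ {y} → ¬ T (Q y) → ∀ x (px? : Dec (T (P x))) → hitsBy x px? y ≡ 0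
  hitsBy-none ¬qy x (yes px) = cong 𝟙 (dec-false (_ ≟ᴮ _) λ y≡ → ¬qy (subst (T ∘ Q) (sym y≡) (proj₂ (f _))))
  hitsBy-none ¬qy x (no _)   = refl

  column : ∀ y (qy? : Dec (T (Q y))) → ∑[ x ∈ xs ] hits x y ≡ 𝟙 (does qy?)
  column y (yes qy) = trans (∑-cong xs (λ x → hitsBy-from qy x (T? (P x)))) (xs-once _ (proj₂ (f⁻¹ (y , qy))))
  column y (no ¬qy) = trans (∑-cong xs (λ x → hitsBy-none ¬qy x (T? (P x)))) (∑-zero xs)

∑-allFin-suc : ∀ {n} (f : Fin (suc n) → ℕ) → ∑ (allFin (suc n)) f ≡ f Fin.zero + ∑[ i ∈ allFin n ] f (Fin.suc i)
∑-allFin-suc {n} f = cong (f Fin.zero +_) (begin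
  ∑ (tabulate Fin.suc) f             ≡⟨ cong (λ is → ∑ is f) (sym (map-tabulate id Fin.suc)) ⟩
  ∑ (map Fin.suc (allFin n)) f       ≡⟨ ∑-map (allFin n) Fin.suc f ⟩
  ∑[ i ∈ allFin n ] f (Fin.suc i)    ∎)
  where open ≡-Reasoning

∑-upTo-suc : ∀ n (f : ℕ → ℕ) → ∑ (upTo (suc n)) f ≡ f 0 + ∑[ i ∈ upTo n ] f (suc i)
∑-upTo-suc n f = cong (f 0 +_) (begin
  ∑ (applyUpTo suc n) f        ≡⟨ cong (λ is → ∑ is f) (sym (map-applyUpTo id suc n)) ⟩
  ∑ (map suc (upTo n)) f       ≡⟨ ∑-map (upTo n) suc f ⟩
  ∑[ i ∈ upTo n ] f (suc i)    ∎)
  where open ≡-Reasoning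

allFin-once : ∀ {n} (i : Fin n) → OccursOnce Fin._≟_ (allFin n) i
allFin-once {suc n} Fin.zero    = trans (∑-allFin-suc {n} (λ x → 𝟙 (does (x Fin.≟ Fin.zero)))) (cong suc (∑-zero (allFin n)))
allFin-once {suc n} (Fin.suc i) = trans (∑-allFin-suc {n} (λ x → 𝟙 (does (x Fin.≟ Fin.suc i)))) (allFin-once i)

upTo-once : ∀ {n i} → i < n → OccursOnce ℕ._≟_ (upTo n) i
upTo-once {suc n} {zero}  _         = trans (∑-upTo-suc n (λ x → 𝟙 (does (x ℕ.≟ 0)))) (cong suc (∑-zero (upTo n)))
upTo-once {suc n} {suc i} (s≤s i<n) = trans (∑-upTo-suc n (λ x → 𝟙 (does (x ℕ.≟ suc i)))) (upTo-once i<n)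

cartesianProduct-once : (_≟ᴬ_ : DecidableEquality A) (_≟ᴮ_ : DecidableEquality B)
                        {xs : List A} {ys : List B} {a : A} {b : B} →
                        OccursOnce _≟ᴬ_ xs a → OccursOnce _≟ᴮ_ ys b →
                        OccursOnce (×.≡-dec _≟ᴬ_ _≟ᴮ_) (cartesianProduct xs ys) (a , b)
cartesianProduct-once _≟ᴬ_ _≟ᴮ_ {xs} {ys} {a} {b} a-once b-once = begin
  ∑ (cartesianProduct xs ys) (λ z → 𝟙 (does (z ≟ (a , b))))
    ≡⟨ ∑-cartesianProduct xs ys _ ⟩
  ∑[ x ∈ xs ] ∑[ y ∈ ys ] 𝟙 (does ((x , y) ≟ (a , b)))
    ≡⟨ ∑-cong xs (λ x → ∑-cong ys (pair-test x)) ⟩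
  ∑[ x ∈ xs ] ∑[ y ∈ ys ] (𝟙 (does (x ≟ᴬ a)) * 𝟙 (does (y ≟ᴮ b)))
    ≡⟨ ∑-*-∑ xs ys _ _ ⟩
  ∑[ x ∈ xs ] 𝟙 (does (x ≟ᴬ a)) * ∑[ y ∈ ys ] 𝟙 (does (y ≟ᴮ b))
    ≡⟨ cong₂ _*_ a-once b-once ⟩
  1 ∎
  where
  open ≡-Reasoning
  _≟_ = ×.≡-dec _≟ᴬ_ _≟ᴮ_
  pair-test : ∀ x y → 𝟙 (does ((x , y) ≟ (a , b))) ≡ 𝟙 (does (x ≟ᴬ a)) * 𝟙 (does (y ≟ᴮ b))
  pair-test x y = trans (cong 𝟙 (does-⇔ (mk⇔ ×.,-injective (uncurry (cong₂ _,_))) ((x , y) ≟ (a , b)) ((x ≟ᴬ a) ×-dec (y ≟ᴮ b))))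
                        (𝟙-∧ (does (x ≟ᴬ a)) (does (y ≟ᴮ b)))

allVecs-once : ∀ n k (v : Vec (Fin n) k) → OccursOnce (Vec.≡-dec Fin._≟_) (allVecs n k) v
allVecs-once n zero    []       = refl
allVecs-once n (suc k) (a ∷ as) = begin
  ∑ (allVecs n (suc k)) (λ v → 𝟙 (does (v ≟ (a ∷ as))))
    ≡⟨ ∑-concatMap (allFin n) _ _ ⟩
  ∑[ x ∈ allFin n ] ∑ (map (x ∷_) (allVecs n k)) (λ v → 𝟙 (does (v ≟ (a ∷ as))))
    ≡⟨ ∑-cong (allFin n) (λ x → trans (∑-map (allVecs n k) (x ∷_) _)
                                      (∑-cong (allVecs n k) (λ v → 𝟙-∧ (does (x Fin.≟ a)) (does (v ≟ as))))) ⟩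
  ∑[ x ∈ allFin n ] ∑[ v ∈ allVecs n k ] (𝟙 (does (x Fin.≟ a)) * 𝟙 (does (v ≟ as)))
    ≡⟨ ∑-*-∑ (allFin n) (allVecs n k) _ _ ⟩
  ∑[ x ∈ allFin n ] 𝟙 (does (x Fin.≟ a)) * ∑[ v ∈ allVecs n k ] 𝟙 (does (v ≟ as))
    ≡⟨ cong₂ _*_ (allFin-once a) (allVecs-once n k as) ⟩
  1 ∎
  where
  open ≡-Reasoning
  _≟_ : ∀ {k} → DecidableEquality (Vec (Fin n) k)
  _≟_ = Vec.≡-dec Fin._≟_

IsLeast : (ℕ → Set) → ℕ → Set
IsLeast P t = P t × (∀ {s} → s < t → ¬ P s)

least : {P : ℕ → Set} → U.Decidable P → ∀ K → P K → ∃ (IsLeast P)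
least P? K pK with P? 0
... | yes p0 = 0 , p0 , λ ()
least P? zero    pK | no ¬p0 = ⊥-elim (¬p0 pK)
least P? (suc K) pK | no ¬p0 with least (P? ∘ suc) K pK
... | t , pt , below = suc t , pt , λ { {zero} _ → ¬p0 ; {suc s} (s≤s s<t) → below s<t }

least-≤ : ∀ {P t K} → IsLeast P t → P K → t ≤ K
least-≤ (_ , below) pK = ≮⇒≥ (λ K<t → below K<t pK)

least-unique : ∀ {P t t′} → IsLeast P t → IsLeast P t′ → t ≡ t′
least-unique {t = t} {t′} (pt , below) (pt′ , below′) with <-cmp t t′
... | tri< t<t′ _ _ = ⊥-elim (below′ t<t′ pt)
... | tri≈ _ t≡t′ _ = t≡t′
... | tri> _ _ t′<t = ⊥-elim (below t′<t pt′)

maximum : ∀ {n} {P : Fin n → Set} → U.Decidable P → ∀ {x} → P x → ∃ λ m → P m × (∀ {y} → P y → toℕ y ≤ toℕ m)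
maximum {n} {P} P? {x} px = let m , pm , ub = maximum-of (allFin n) in m , pm , ub (∈-allFin _)
  where
  maximum-of : (ys : List (Fin n)) → ∃ λ m → P m × (∀ {y} → y ∈ ys → P y → toℕ y ≤ toℕ m)
  maximum-of []       = x , px , λ ()
  maximum-of (y ∷ ys) with maximum-of ys | P? y
  ... | m , pm , ub | no ¬py = m , pm , λ { (here refl) py → ⊥-elim (¬py py) ; (there y∈) → ub y∈ }
  ... | m , pm , ub | yes py with toℕ y ≤? toℕ m
  ...   | yes y≤m = m , pm , λ { (here refl) _ → y≤m ; (there y∈) → ub y∈ }
  ...   | no  y≰m = y , py , λ { (here refl) _ → ≤-refl ; (there y∈) pz → ≤-trans (ub y∈ pz) (<⇒≤ (≰⇒> y≰m)) }

module _ {n} (p : ParentMap n) where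

  iter-+ : ∀ a b x → iter p (a + b) x ≡ iter p a (iter p b x)
  iter-+ zero    b x = refl
  iter-+ (suc a) b x = cong (lookup p) (iter-+ a b x)

  iter-fixed : ∀ {r} → lookup p r ≡ r → ∀ k → iter p k r ≡ r
  iter-fixed pr≡r zero    = refl
  iter-fixed pr≡r (suc k) = trans (cong (lookup p) (iter-fixed pr≡r k)) pr≡r

  iter-stays : ∀ {r x a b} → lookup p r ≡ r → iter p a x ≡ r → a ≤ b → iter p b x ≡ r
  iter-stays {r} {x} {a} {b} pr≡r hit a≤b = begin
    iter p b x                  ≡⟨ cong (λ k → iter p k x) (sym (m∸n+n≡m a≤b)) ⟩
    iter p ((b ∸ a) + a) x      ≡⟨ iter-+ (b ∸ a) a x ⟩
    iter p (b ∸ a) (iter p a x) ≡⟨ cong (iter p (b ∸ a)) hit ⟩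
    iter p (b ∸ a) r            ≡⟨ iter-fixed pr≡r (b ∸ a) ⟩
    r                           ∎
    where open ≡-Reasoning

  iter-periodic : ∀ {x} k → iter p (suc k) x ≡ x → ∀ m → iter p (m * suc k) x ≡ x
  iter-periodic k period zero    = refl
  iter-periodic {x} k period (suc m) = begin
    iter p (suc k + m * suc k) x         ≡⟨ iter-+ (suc k) (m * suc k) x ⟩
    iter p (suc k) (iter p (m * suc k) x) ≡⟨ cong (iter p (suc k)) (iter-periodic k period m) ⟩
    iter p (suc k) x                     ≡⟨ period ⟩
    x                                    ∎
    where open ≡-Reasoning

  -- Among the first n + 1 iterates of x two coincide, so a walk longer than n has a loop to cut out.
  iter-shortcut : ∀ {K} x → n < K → ∃ λ K′ → K′ < K × iter p K′ x ≡ iter p K x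
  iter-shortcut {K} x n<K with Fin.pigeonhole (n<1+n n) (λ (t : Fin (suc n)) → iter p (toℕ t) x)
  ... | i , j , i<j , same = (K ∸ b) + a , shorter , (begin
    iter p ((K ∸ b) + a) x      ≡⟨ iter-+ (K ∸ b) a x ⟩
    iter p (K ∸ b) (iter p a x) ≡⟨ cong (iter p (K ∸ b)) same ⟩
    iter p (K ∸ b) (iter p b x) ≡⟨ iter-+ (K ∸ b) b x ⟨
    iter p ((K ∸ b) + b) x      ≡⟨ cong (λ k → iter p k x) (m∸n+n≡m b≤K) ⟩
    iter p K x                  ∎)
    where
    open ≡-Reasoning
    a = toℕ i
    b = toℕ j
    b≤K : b ≤ K
    b≤K = ≤-trans (Fin.toℕ≤pred[n] j) (<⇒≤ n<K)
    shorter : (K ∸ b) + a < K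
    shorter = ≤-trans (+-monoʳ-< (K ∸ b) i<j) (≤-reflexive (m∸n+n≡m b≤K))

  reach-within-n : ∀ {r x} → lookup p r ≡ r → ∀ K → iter p K x ≡ r → iter p n x ≡ r
  reach-within-n {r} {x} pr≡r = <-rec (λ K → iter p K x ≡ r → iter p n x ≡ r) step
    where
    step : ∀ K → (∀ {K′} → K′ < K → iter p K′ x ≡ r → iter p n x ≡ r) → iter p K x ≡ r → iter p n x ≡ r
    step K shorter hit with K ≤? n
    ... | yes K≤n = iter-stays pr≡r hit K≤n
    ... | no  K≰n with iter-shortcut x (≰⇒> K≰n)
    ...   | K′ , K′<K , same = shorter K′<K (trans same hit)

iter-agree : ∀ {n} (q₁ q₂ : ParentMap n) (B : Fin n → Set) → (∀ {y} → ¬ B y → lookup q₁ y ≡ lookup q₂ y) →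
             ∀ k x → (∀ {s} → s < k → ¬ B (iter q₂ s x)) → iter q₁ k x ≡ iter q₂ k x
iter-agree q₁ q₂ B agree zero    x avoid = refl
iter-agree q₁ q₂ B agree (suc k) x avoid =
  trans (cong (lookup q₁) (iter-agree q₁ q₂ B agree k x (avoid ∘ m≤n⇒m≤1+n))) (agree (avoid ≤-refl))

lookup-ext : ∀ {n} {xs ys : ParentMap n} → (∀ i → lookup xs i ≡ lookup ys i) → xs ≡ ys
lookup-ext {xs = xs} {ys} eq = trans (sym (Vec.tabulate∘lookup xs)) (trans (Vec.tabulate-cong eq) (Vec.tabulate∘lookup ys))

RootedAt : ∀ {n} → ParentMap n → Fin n → Set
RootedAt {n} p r = lookup p r ≡ r × (∀ v → iter p n v ≡ r)

isRootedAt : ∀ {n} → ParentMap n → Fin n → Bool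
isRootedAt {n} p r = (lookup p r == r) ∧ all (λ v → iter p n v == r) (allFin n)

module _ {n} {p : ParentMap n} {r : Fin n} where

  private
    reachesRoot : Fin n → Bool
    reachesRoot v = iter p n v == r

  isRootedAt⁺ : RootedAt p r → T (isRootedAt p r)
  isRootedAt⁺ (pr≡r , reach) = Equivalence.from T-∧
    ( fromWitness {a? = lookup p r Fin.≟ r} pr≡r
    , all⁻ reachesRoot {allFin n} (All.tabulate λ {v} _ → fromWitness {a? = iter p n v Fin.≟ r} (reach v)))

  isRootedAt⁻ : T (isRootedAt p r) → RootedAt p r
  isRootedAt⁻ h = let pr≡r , reach = Equivalence.to (T-∧ {lookup p r == r}) h in
    toWitness pr≡r , λ v → toWitness (All.lookup (all⁺ reachesRoot (allFin n) reach) (∈-allFin v))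

  isRootedTree⁺ : RootedAt p r → T (isRootedTree p)
  isRootedTree⁺ rooted = any⁺ (isRootedAt p) (lose (∈-allFin r) (isRootedAt⁺ rooted))

  rootedAt-reachable : lookup p r ≡ r → (∀ x → ∃ λ K → iter p K x ≡ r) → RootedAt p r
  rootedAt-reachable pr≡r reach = pr≡r , λ x → reach-within-n p pr≡r (proj₁ (reach x)) (proj₂ (reach x))

isRootedTree⁻ : ∀ {n} {p : ParentMap n} → T (isRootedTree p) → ∃ (RootedAt p)
isRootedTree⁻ {n} {p} h = let r , rooted = satisfied (any⁻ (isRootedAt p) (allFin n) h) in r , isRootedAt⁻ rooted

module _ {n} {p : ParentMap n} {r : Fin n} (rooted : RootedAt p r) where

  rooted-iter-≥ : ∀ {k} v → n ≤ k → iter p k v ≡ r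
  rooted-iter-≥ v n≤k = iter-stays p (proj₁ rooted) (proj₂ rooted v) n≤k

  periodic⇒root : ∀ {x} k → iter p (suc k) x ≡ x → x ≡ r
  periodic⇒root {x} k period = trans (sym (iter-periodic p k period n)) (rooted-iter-≥ x (m≤m*n n (suc k)))

  repeat⇒root : ∀ {w a b} → a < b → iter p a w ≡ iter p b w → iter p a w ≡ r
  repeat⇒root {w} {a} {suc b} (s≤s a≤b) same = periodic⇒root (b ∸ a) (begin
    iter p (suc (b ∸ a)) (iter p a w) ≡⟨ iter-+ p (suc (b ∸ a)) a w ⟨
    iter p (suc (b ∸ a + a)) w        ≡⟨ cong (λ k → iter p (suc k) w) (m∸n+n≡m a≤b) ⟩
    iter p (suc b) w                  ≡⟨ same ⟨
    iter p a w                        ∎)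
    where open ≡-Reasoning

module _ {n} {p : ParentMap n} {v : Fin n} where

  isRecord⁺ : (∀ k → toℕ (iter p k v) ≤ toℕ v) → T (isRecord p v)
  isRecord⁺ bound = all⁻ (λ k → toℕ (iter p k v) ≤ᵇ toℕ v) {upTo (suc n)} (All.tabulate λ {k} _ → ≤⇒≤ᵇ (bound k))

  private
    isRecord⁻-≤n : T (isRecord p v) → ∀ {k} → k ≤ n → toℕ (iter p k v) ≤ toℕ v
    isRecord⁻-≤n rec k≤n =
      ≤ᵇ⇒≤ _ _ (All.lookup (all⁺ (λ k → toℕ (iter p k v) ≤ᵇ toℕ v) (upTo (suc n)) rec) (∈-upTo⁺ (s≤s k≤n)))

  isRecord⁻ : ∀ {r} → RootedAt p r → T (isRecord p v) → ∀ k → toℕ (iter p k v) ≤ toℕ v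
  isRecord⁻ rooted rec k with k ≤? n
  ... | yes k≤n = isRecord⁻-≤n rec k≤n
  ... | no  k≰n = subst (λ y → toℕ y ≤ toℕ v) (trans (proj₂ rooted v) (sym (rooted-iter-≥ rooted v (<⇒≤ (≰⇒> k≰n)))))
                        (isRecord⁻-≤n rec ≤-refl)

root-isRecord : ∀ {n} {p : ParentMap n} {r} → RootedAt p r → T (isRecord p r)
root-isRecord {p = p} rooted = isRecord⁺ λ k → ≤-reflexive (cong toℕ (iter-fixed p (proj₁ rooted) k))

records-count : ∀ {n} {p : ParentMap n} {r} → RootedAt p r → ∑[ v ∈ allFin n ] 𝟙 (isRecord p v) ≡ nonRootRecords p + 1
records-count {n} {p} {r} rooted = begin
  ∑[ v ∈ allFin n ] 𝟙 (isRecord p v)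
    ≡⟨ ∑-cong (allFin n) (λ v → 𝟙-∧-not (isRecord p v) (v == rootFrom p v)) ⟨
  ∑[ v ∈ allFin n ] (𝟙 (isNonRootRecord p v) + 𝟙 (isRecord p v ∧ (v == rootFrom p v)))
    ≡⟨ ∑-+ (allFin n) _ _ ⟩
  ∑[ v ∈ allFin n ] 𝟙 (isNonRootRecord p v) + ∑[ v ∈ allFin n ] 𝟙 (isRecord p v ∧ (v == rootFrom p v))
    ≡⟨ cong₂ _+_ (length-filterᵇ (isNonRootRecord p) (allFin n)) (∑-cong (allFin n) root-term) ⟨
  nonRootRecords p + ∑[ v ∈ allFin n ] 𝟙 (does (v Fin.≟ r))
    ≡⟨ cong (nonRootRecords p +_) (allFin-once r) ⟩
  nonRootRecords p + 1 ∎
  where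
  open ≡-Reasoning
  root-term : ∀ v → 𝟙 (does (v Fin.≟ r)) ≡ 𝟙 (isRecord p v ∧ (v == rootFrom p v))
  root-term v rewrite proj₂ rooted v with v Fin.≟ r
  ... | yes refl rewrite Equivalence.to T-≡ (root-isRecord rooted) = refl
  ... | no _ = cong 𝟙 (sym (∧-zeroʳ (isRecord p v)))

-- Connected maps

-- The functional graph of g is connected, i.e. has exactly one cycle, iff redirecting some vertex to itself
-- leaves a rooted tree.
isConnected : ∀ {n} → ParentMap n → Bool
isConnected {n} g = any (λ r → isRootedAt (g [ r ]≔ r) r) (allFin n)

isCyclic : ∀ {n} → ParentMap n → Fin n → Bool
isCyclic {n} g x = any (λ k → iter g (suc k) x == x) (upTo (suc n))

module _ {n} {g : ParentMap n} where

  isConnected⁺ : ∀ {r} → RootedAt (g [ r ]≔ r) r → T (isConnected g)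
  isConnected⁺ {r} rooted = any⁺ (λ r → isRootedAt (g [ r ]≔ r) r) (lose (∈-allFin r) (isRootedAt⁺ rooted))

  isConnected⁻ : T (isConnected g) → ∃ λ r → RootedAt (g [ r ]≔ r) r
  isConnected⁻ h = let r , rooted = satisfied (any⁻ (λ r → isRootedAt (g [ r ]≔ r) r) (allFin n) h) in
    r , isRootedAt⁻ rooted

module _ {n} (g : ParentMap n) where

  isCyclic⁺ : ∀ {x k} → k ≤ n → iter g (suc k) x ≡ x → T (isCyclic g x)
  isCyclic⁺ {x} {k} k≤n period =
    any⁺ (λ k → iter g (suc k) x == x) (lose (∈-upTo⁺ (s≤s k≤n)) (fromWitness {a? = iter g (suc k) x Fin.≟ x} period))

  isCyclic⁻ : ∀ {x} → T (isCyclic g x) → ∃ λ k → iter g (suc k) x ≡ x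
  isCyclic⁻ {x} h = let k , period = satisfied (any⁻ (λ k → iter g (suc k) x == x) (upTo (suc n)) h) in
    k , toWitness period

OnRootPath : ∀ {n} → ParentMap n → Fin n → Fin n → Set
OnRootPath p w x = ∃ λ k → iter p k w ≡ x

-- r is the predecessor of c on the cycle of g.
CutPoint : ∀ {n} → ParentMap n → Fin n → Fin n → Set
CutPoint g c r = RootedAt (g [ r ]≔ r) r × lookup g r ≡ c

IsCycleMax : ∀ {n} → ParentMap n → Fin n → Set
IsCycleMax g c = T (isCyclic g c) × (∀ {y} → T (isCyclic g y) → toℕ y ≤ toℕ c)

module Reattach {n} {p : ParentMap n} {r} (rooted : RootedAt p r) {g : ParentMap n} {w : Fin n}
                (g-off-root : ∀ {y} → y ≢ r → lookup g y ≡ lookup p y) (g-root : lookup g r ≡ w) where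

  cut-restores : g [ r ]≔ r ≡ p
  cut-restores = lookup-ext λ y → case y Fin.≟ r of λ where
    (yes refl) → trans (Vec.lookup∘update r g r) (sym (proj₁ rooted))
    (no y≢r)   → trans (Vec.lookup∘update′ y≢r g r) (g-off-root y≢r)

  cutPoint : CutPoint g w r
  cutPoint = subst (λ q → RootedAt q r) (sym cut-restores) rooted , g-root

  connected : T (isConnected g)
  connected = isConnected⁺ (proj₁ cutPoint)

  agrees-before-root : ∀ {x t} → IsLeast (λ t → iter p t x ≡ r) t → ∀ {k} → k ≤ t → iter g k x ≡ iter p k x
  agrees-before-root (_ , below) k≤t = iter-agree g p (_≡ r) g-off-root _ _ (λ s<k → below (≤-trans s<k k≤t))

  reaches-root : ∀ x → ∃ λ t → iter g t x ≡ r
  reaches-root x = let t , least-t = least (λ t → iter p t x Fin.≟ r) n (proj₂ rooted x) in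
    t , trans (agrees-before-root least-t ≤-refl) (proj₁ least-t)

  onRootPath-root : OnRootPath p w r
  onRootPath-root = n , proj₂ rooted w

  onRootPath-step : ∀ {x} → OnRootPath p w x → OnRootPath p w (lookup g x)
  onRootPath-step {x} (k , hit) with x Fin.≟ r
  ... | yes refl = 0 , sym g-root
  ... | no x≢r   = suc k , trans (cong (lookup p) hit) (sym (g-off-root x≢r))

  onRootPath-iter : ∀ {x} k → OnRootPath p w x → OnRootPath p w (iter g k x)
  onRootPath-iter zero    on = on
  onRootPath-iter (suc k) on = onRootPath-step (onRootPath-iter k on)

  -- A cyclic x is reached from r, because the walk from x passes through r and comes back to x.
  isCyclic⇒onRootPath : ∀ {x} → T (isCyclic g x) → OnRootPath p w x
  isCyclic⇒onRootPath {x} cyclic = subst (OnRootPath p w) returns (onRootPath-iter (t * suc k ∸ t) onRootPath-root)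
    where
    open ≡-Reasoning
    k = proj₁ (isCyclic⁻ g cyclic)
    t = proj₁ (reaches-root x)
    returns : iter g (t * suc k ∸ t) r ≡ x
    returns = begin
      iter g (t * suc k ∸ t) r            ≡⟨ cong (iter g (t * suc k ∸ t)) (proj₂ (reaches-root x)) ⟨
      iter g (t * suc k ∸ t) (iter g t x) ≡⟨ iter-+ g (t * suc k ∸ t) t x ⟨
      iter g (t * suc k ∸ t + t) x        ≡⟨ cong (λ m → iter g m x) (m∸n+n≡m (m≤m*n t (suc k))) ⟩
      iter g (t * suc k) x                ≡⟨ iter-periodic g k (proj₂ (isCyclic⁻ g cyclic)) t ⟩
      x                                   ∎

  depth-least : ∃ (IsLeast (λ t → iter p t w ≡ r))
  depth-least = least (λ t → iter p t w Fin.≟ r) n (proj₂ rooted w)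

  depth : ℕ
  depth = proj₁ depth-least

  private
    depth-hits-root : iter p depth w ≡ r
    depth-hits-root = proj₁ (proj₂ depth-least)

    below-depth : ∀ {s} → s < depth → iter p s w ≢ r
    below-depth = proj₂ (proj₂ depth-least)

    g-depth-hits-root : iter g depth w ≡ r
    g-depth-hits-root = trans (agrees-before-root (proj₂ depth-least) ≤-refl) depth-hits-root

  onRootPath-within-depth : ∀ {x} → OnRootPath p w x → ∃ λ k → k ≤ depth × iter p k w ≡ x
  onRootPath-within-depth (k , hit) with k ≤? depth
  ... | yes k≤d = k , k≤d , hit
  ... | no  k≰d = depth , ≤-refl ,
    trans depth-hits-root (trans (sym (iter-stays p (proj₁ rooted) depth-hits-root (<⇒≤ (≰⇒> k≰d)))) hit)

  onRootPath⇒periodic : ∀ {x} → OnRootPath p w x → iter g (suc depth) x ≡ x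
  onRootPath⇒periodic {x} on = begin
    iter g (suc depth) x                  ≡⟨ cong (iter g (suc depth)) from-w ⟨
    iter g (suc depth) (iter g k w)       ≡⟨ iter-+ g (suc depth) k w ⟨
    iter g (suc depth + k) w              ≡⟨ cong (λ m → iter g m w) (+-comm (suc depth) k) ⟩
    iter g (k + suc depth) w              ≡⟨ iter-+ g k (suc depth) w ⟩
    iter g k (lookup g (iter g depth w))  ≡⟨ cong (iter g k ∘ lookup g) g-depth-hits-root ⟩
    iter g k (lookup g r)                 ≡⟨ cong (iter g k) g-root ⟩
    iter g k w                            ≡⟨ from-w ⟩
    x                                     ∎
    where
    open ≡-Reasoning
    k = proj₁ (onRootPath-within-depth on)
    from-w : iter g k w ≡ x
    from-w = let k≤d , hit = proj₂ (onRootPath-within-depth on) in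
      trans (agrees-before-root (proj₂ depth-least) k≤d) hit

  onRootPath⇒isCyclic : ∀ {x} → OnRootPath p w x → T (isCyclic g x)
  onRootPath⇒isCyclic on = isCyclic⁺ g (least-≤ (proj₂ depth-least) (proj₂ rooted w)) (onRootPath⇒periodic on)

  -- Walking up from x in p, the first stop among {r′, r} is either r′ itself, or r, whose new edge leads to w
  -- and from there back up to r′.
  reroot : ∀ {j} → j < depth → RootedAt (g [ iter p j w ]≔ iter p j w) (iter p j w)
  reroot {j} j<d = rootedAt-reachable (Vec.lookup∘update r′ g r′) reach
    where
    open ≡-Reasoning
    r′ = iter p j w
    q = g [ r′ ]≔ r′
    r≢r′ : r ≢ r′
    r≢r′ r≡r′ = below-depth j<d (sym r≡r′)
    Stop : Fin n → Set
    Stop y = y ≡ r′ ⊎ y ≡ r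
    q-off-stop : ∀ {y} → ¬ Stop y → lookup q y ≡ lookup p y
    q-off-stop ¬stop = trans (Vec.lookup∘update′ (¬stop ∘ inj₁) g r′) (g-off-root (¬stop ∘ inj₂))
    q≈p-until : ∀ {x} k → (∀ {s} → s < k → ¬ Stop (iter p s x)) → iter q k x ≡ iter p k x
    q≈p-until {x} k = iter-agree q p Stop q-off-stop k x
    path-avoids-stop : ∀ {s} → s < j → ¬ Stop (iter p s w)
    path-avoids-stop s<j (inj₁ same) = below-depth (<-trans s<j j<d) (repeat⇒root rooted s<j same)
    path-avoids-stop s<j (inj₂ hit)  = below-depth (<-trans s<j j<d) hit
    reach : ∀ x → ∃ λ K → iter q K x ≡ r′
    reach x with least (λ t → (iter p t x Fin.≟ r′) ⊎-dec (iter p t x Fin.≟ r)) n (inj₂ (proj₂ rooted x))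
    ... | t , inj₁ hit′ , before = t , trans (q≈p-until t before) hit′
    ... | t , inj₂ hit  , before = j + suc t , (begin
      iter q (j + suc t) x             ≡⟨ iter-+ q j (suc t) x ⟩
      iter q j (lookup q (iter q t x)) ≡⟨ cong (iter q j ∘ lookup q) (trans (q≈p-until t before) hit) ⟩
      iter q j (lookup q r)            ≡⟨ cong (iter q j) (trans (Vec.lookup∘update′ r≢r′ g r′) g-root) ⟩
      iter q j w                       ≡⟨ q≈p-until j path-avoids-stop ⟩
      r′                               ∎)

  cutPoint-exists : ∀ {c} → OnRootPath p w c → ∃ (CutPoint g c)
  cutPoint-exists on with onRootPath-within-depth on
  ... | zero  , _   , refl = r , cutPoint
  ... | suc j , j<d , refl = iter p j w , reroot j<d , g-off-root (below-depth j<d)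

  isRecord⇒cycleMax : T (isRecord p w) → IsCycleMax g w
  isRecord⇒cycleMax rec = onRootPath⇒isCyclic (0 , refl) , λ cyclic →
    let k , hit = isCyclic⇒onRootPath cyclic in subst (λ y → toℕ y ≤ toℕ w) hit (isRecord⁻ rooted rec k)

  cycleMax⇒isRecord : IsCycleMax g w → T (isRecord p w)
  cycleMax⇒isRecord (_ , maximal) = isRecord⁺ λ k → maximal (onRootPath⇒isCyclic (k , refl))

  agrees-before-cycle : ∀ {x k} → (∀ {s} → s < k → ¬ T (isCyclic g (iter g s x))) → iter p k x ≡ iter g k x
  agrees-before-cycle {x} {k} acyclic = iter-agree p g (_≡ r) (sym ∘ g-off-root) k x
    λ s<k same → acyclic s<k (subst (T ∘ isCyclic g) (sym same) (onRootPath⇒isCyclic onRootPath-root))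

module CutAt {n} {g : ParentMap n} {c r} (cp : CutPoint g c r) =
  Reattach (proj₁ cp) {g} (λ y≢r → sym (Vec.lookup∘update′ y≢r g r)) (proj₂ cp)

-- r₂ is cyclic, so it lies on the path from c up to r₁ in g [ r₁ ]≔ r₁; if r₂ ≠ r₁, its edge leads back
-- to c, which makes c periodic in a tree, so c = r₁ and the path collapses to r₁.
cutPoint-unique : ∀ {n} {g : ParentMap n} {c r₁ r₂} → CutPoint g c r₁ → CutPoint g c r₂ → r₁ ≡ r₂
cutPoint-unique {g = g} {c} {r₁} {r₂} cp₁ cp₂ with r₂ Fin.≟ r₁
... | yes r₂≡r₁ = sym r₂≡r₁
... | no  r₂≢r₁ = sym (begin
  r₂                  ≡⟨ hit ⟨
  iter p₁ m c         ≡⟨ cong (iter p₁ m) c≡r₁ ⟩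
  iter p₁ m r₁        ≡⟨ iter-fixed p₁ (proj₁ (proj₁ cp₁)) m ⟩
  r₁                  ∎)
  where
  open ≡-Reasoning
  module C₁ = CutAt cp₁
  module C₂ = CutAt cp₂
  p₁ = g [ r₁ ]≔ r₁
  m = proj₁ (C₁.isCyclic⇒onRootPath (C₂.onRootPath⇒isCyclic C₂.onRootPath-root))
  hit : iter p₁ m c ≡ r₂
  hit = proj₂ (C₁.isCyclic⇒onRootPath (C₂.onRootPath⇒isCyclic C₂.onRootPath-root))
  c≡r₁ : c ≡ r₁
  c≡r₁ = periodic⇒root (proj₁ cp₁) m (begin
    lookup p₁ (iter p₁ m c) ≡⟨ cong (lookup p₁) hit ⟩
    lookup p₁ r₂            ≡⟨ Vec.lookup∘update′ r₂≢r₁ g r₁ ⟩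
    lookup g r₂             ≡⟨ proj₂ cp₂ ⟩
    c                       ∎)

module Connected {n} {g : ParentMap n} (connected : T (isConnected g)) where

  private
    r₀ = proj₁ (isConnected⁻ {n} {g} connected)
    module C₀ = CutAt {n} {g} {lookup g r₀} (proj₂ (isConnected⁻ {n} {g} connected) , refl)

  -- Only the existence of these witnesses matters; opacity keeps the type checker from unfolding their
  -- proofs when it compares terms built from them.
  opaque
    cutPoint-of-cyclic : ∀ {c} → T (isCyclic g c) → ∃ (CutPoint g c)
    cutPoint-of-cyclic cyclic = C₀.cutPoint-exists (C₀.isCyclic⇒onRootPath cyclic)

    reaches-cycle : ∀ x → ∃ λ t → T (isCyclic g (iter g t x))
    reaches-cycle x = let t , hit = C₀.reaches-root x in
      t , subst (T ∘ isCyclic g) (sym hit) (C₀.onRootPath⇒isCyclic C₀.onRootPath-root)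

    cycleMax-exists : ∃ (IsCycleMax g)
    cycleMax-exists = maximum (T? ∘ isCyclic g) (C₀.onRootPath⇒isCyclic C₀.onRootPath-root)

cycleMax-unique : ∀ {n} {g : ParentMap n} {c c′} → IsCycleMax g c → IsCycleMax g c′ → c ≡ c′
cycleMax-unique (cyclic , maximal) (cyclic′ , maximal′) =
  Fin.toℕ-injective (≤-antisym (maximal′ cyclic) (maximal cyclic′))

attach : ∀ {n} → ParentMap n → Fin n → ParentMap n
attach p v = p [ rootFrom p v ]≔ v

attach∘cut : ∀ {n} {g : ParentMap n} {c r} → CutPoint g c r → attach (g [ r ]≔ r) c ≡ g
attach∘cut {g = g} {c} {r} (rooted , gr≡c) = begin
  (g [ r ]≔ r) [ rootFrom (g [ r ]≔ r) c ]≔ c ≡⟨ cong (λ r′ → (g [ r ]≔ r) [ r′ ]≔ c) (proj₂ rooted c) ⟩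
  (g [ r ]≔ r) [ r ]≔ c                       ≡⟨ Vec.[]≔-idempotent g r ⟩
  g [ r ]≔ c                                  ≡⟨ cong (g [ r ]≔_) gr≡c ⟨
  g [ r ]≔ lookup g r                         ≡⟨ Vec.[]≔-lookup g r ⟩
  g                                           ∎
  where open ≡-Reasoning

module _ {n} {p : ParentMap n} {r} (rooted : RootedAt p r) (v : Fin n) where

  attach-off-root : ∀ {y} → y ≢ r → lookup (attach p v) y ≡ lookup p y
  attach-off-root y≢r rewrite proj₂ rooted v = Vec.lookup∘update′ y≢r p v

  attach-root : lookup (attach p v) r ≡ v
  attach-root rewrite proj₂ rooted v = Vec.lookup∘update r p v

module Attach {n} {p : ParentMap n} {r} (rooted : RootedAt p r) (v : Fin n) =
  Reattach rooted {attach p v} {v} (attach-off-root rooted v) (attach-root rooted v)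

cut∘attach : ∀ {n} {p : ParentMap n} {r w c r′} → RootedAt p r → CutPoint (attach p w) c r′ → c ≡ w →
             attach p w [ r′ ]≔ r′ ≡ p
cut∘attach {p = p} {r} {w} rooted cp refl =
  trans (cong (λ r′ → attach p w [ r′ ]≔ r′) (cutPoint-unique cp (Attach.cutPoint rooted w)))
        (Attach.cut-restores rooted w)

EntersCycleAt : ∀ {n} → ParentMap n → Fin n → ℕ → Set
EntersCycleAt g c = IsLeast (λ t → T (isCyclic g (iter g t c)))

module AttachAncestor {n} {p : ParentMap n} {r} (rooted : RootedAt p r) (v : Fin n) (i : ℕ)
                      (not-root : iter p i v ≢ r) where

  private
    w = iter p (suc i) v
    g = attach p w
    open Attach rooted w using (onRootPath⇒isCyclic; isCyclic⇒onRootPath)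

  path-avoids-root : ∀ {s} → s < suc i → iter p s v ≢ r
  path-avoids-root (s≤s s≤i) hit = not-root (iter-stays p (proj₁ rooted) hit s≤i)

  agrees : ∀ {k} → k ≤ suc i → iter g k v ≡ iter p k v
  agrees k≤ = iter-agree g p (_≡ r) (attach-off-root rooted w) _ v (λ s<k → path-avoids-root (≤-trans s<k k≤))

  -- A cyclic vertex on the path would be reached again from w, and in a tree only the root repeats.
  acyclic-before : ∀ {s} → s < suc i → ¬ T (isCyclic g (iter g s v))
  acyclic-before {s} s<i+1 cyclic = path-avoids-root s<i+1 (repeat⇒root rooted s<k+i+1 (sym (begin
    iter p (k + suc i) v ≡⟨ iter-+ p k (suc i) v ⟩
    iter p k w           ≡⟨ hit ⟩
    iter g s v           ≡⟨ agrees (<⇒≤ s<i+1) ⟩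
    iter p s v           ∎)))
    where
    open ≡-Reasoning
    k = proj₁ (isCyclic⇒onRootPath cyclic)
    hit = proj₂ (isCyclic⇒onRootPath cyclic)
    s<k+i+1 : s < k + suc i
    s<k+i+1 = ≤-trans s<i+1 (m≤n+m (suc i) k)

  enters-cycle : EntersCycleAt g v (suc i)
  enters-cycle = subst (T ∘ isCyclic g) (sym (agrees ≤-refl)) (onRootPath⇒isCyclic (0 , refl)) , acyclic-before

module CutAtEntry {n} {g : ParentMap n} {c i r} (cp : CutPoint g (iter g (suc i) c) r)
                  (entry : EntersCycleAt g c (suc i)) where

  private
    module C = CutAt cp

  agrees : ∀ {k} → k ≤ suc i → iter (g [ r ]≔ r) k c ≡ iter g k c
  agrees k≤ = C.agrees-before-cycle (λ s<k → proj₂ entry (≤-trans s<k k≤))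

  not-root : iter (g [ r ]≔ r) i c ≢ r
  not-root hit = proj₂ entry ≤-refl
    (subst (T ∘ isCyclic g) (trans (sym hit) (agrees (n≤1+n i))) (C.onRootPath⇒isCyclic C.onRootPath-root))

-- Three bijections

module _ {n : ℕ} where

  vertexMarked : ParentMap n × Fin n → Bool
  vertexMarked (p , v) = isRootedTree p

  cyclicMarked : ParentMap n × Fin n → Bool
  cyclicMarked (g , c) = isConnected g ∧ isCyclic g c

  cyclicMarked-cutPoint : ∀ {g c} → T (cyclicMarked (g , c)) → ∃ (CutPoint g c)
  cyclicMarked-cutPoint {g} h = let connected , cyclic = Equivalence.to (T-∧ {isConnected g}) h in
    Connected.cutPoint-of-cyclic connected cyclic

  vertexMarked↔cyclicMarked : ∃ (T ∘ vertexMarked) ↔ ∃ (T ∘ cyclicMarked)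
  vertexMarked↔cyclicMarked = mk↔ₛ′ to from to∘from from∘to
    where
    to : ∃ (T ∘ vertexMarked) → ∃ (T ∘ cyclicMarked)
    to ((p , v) , tree) = let _ , rooted = isRootedTree⁻ tree in
      (attach p v , v) , Equivalence.from T-∧ (Attach.connected rooted v , Attach.onRootPath⇒isCyclic rooted v (0 , refl))

    from : ∃ (T ∘ cyclicMarked) → ∃ (T ∘ vertexMarked)
    from ((g , c) , h) = let r , rooted , _ = cyclicMarked-cutPoint h in (g [ r ]≔ r , c) , isRootedTree⁺ rooted

    to∘from : ∀ y → to (from y) ≡ y
    to∘from ((g , c) , h) = ≡-subtype (cong (_, c) (attach∘cut (proj₂ (cyclicMarked-cutPoint h))))

    from∘to : ∀ x → from (to x) ≡ x
    from∘to x@((p , v) , tree) =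
      ≡-subtype (cong (_, v) (cut∘attach (proj₂ (isRootedTree⁻ tree)) (proj₂ (cyclicMarked-cutPoint (proj₂ (to x)))) refl))

  recordMarked : ParentMap n × Fin n → Bool
  recordMarked (p , v) = isRootedTree p ∧ isRecord p v

  cycleMax-cutPoint : ∀ {g} → T (isConnected g) → Σ (Fin n) λ c → IsCycleMax g c × ∃ (CutPoint g c)
  cycleMax-cutPoint connected = let c , maximal = Connected.cycleMax-exists connected in
    c , maximal , Connected.cutPoint-of-cyclic connected (proj₁ maximal)

  -- v is a record of p iff it is the largest vertex on the cycle of attach p v.
  recordMarked↔connected : ∃ (T ∘ recordMarked) ↔ ∃ (T ∘ isConnected {n})
  recordMarked↔connected = mk↔ₛ′ to from to∘from from∘to
    where
    to : ∃ (T ∘ recordMarked) → ∃ (T ∘ isConnected)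
    to ((p , v) , h) = let _ , rooted = isRootedTree⁻ (proj₁ (Equivalence.to (T-∧ {isRootedTree p}) h)) in
      attach p v , Attach.connected rooted v

    from : ∃ (T ∘ isConnected) → ∃ (T ∘ recordMarked)
    from (g , connected) = let c , maximal , r , cp = cycleMax-cutPoint connected in
      (g [ r ]≔ r , c) , Equivalence.from T-∧ (isRootedTree⁺ (proj₁ cp) , CutAt.cycleMax⇒isRecord cp maximal)

    to∘from : ∀ y → to (from y) ≡ y
    to∘from (g , connected) = ≡-subtype (attach∘cut (proj₂ (proj₂ (proj₂ (cycleMax-cutPoint connected)))))

    from∘to : ∀ x → from (to x) ≡ x
    from∘to x@((p , v) , h) =
      let tree , rec = Equivalence.to (T-∧ {isRootedTree p}) h
          _ , rooted = isRootedTree⁻ tree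
          c , maximal , _ , cp = cycleMax-cutPoint (proj₂ (to x))
          c≡v = cycleMax-unique {g = attach p v} maximal (Attach.isRecord⇒cycleMax rooted v rec)
      in ≡-subtype (cong₂ _,_ (cut∘attach rooted cp c≡v) c≡v)

  heightMarked : ParentMap n × (Fin n × ℕ) → Bool
  heightMarked (p , (v , i)) = isRootedTree p ∧ not (iter p i v == rootFrom p v)

  acyclicMarked : ParentMap n × Fin n → Bool
  acyclicMarked (g , c) = isConnected g ∧ not (isCyclic g c)

  acyclicMarked-entry : ∀ {g c} → T (acyclicMarked (g , c)) →
                        Σ ℕ λ i → EntersCycleAt g c (suc i) × ∃ (CutPoint g (iter g (suc i) c))
  acyclicMarked-entry {g} {c} h with Equivalence.to (T-∧ {isConnected g}) h
  ... | connected , acyclic with uncurry (least (λ t → T? (isCyclic g (iter g t c)))) (Connected.reaches-cycle connected c)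
  ...   | zero  , entry = ⊥-elim (T-not⁻ acyclic (proj₁ entry))
  ...   | suc i , entry = i , entry , Connected.cutPoint-of-cyclic connected (proj₁ entry)

  heightMarked⁻ : ∀ p v i → T (heightMarked (p , (v , i))) → ∃ λ r → RootedAt p r × iter p i v ≢ r
  heightMarked⁻ p v i h =
    let tree , not-root = Equivalence.to (T-∧ {isRootedTree p}) h
        r , rooted = isRootedTree⁻ tree
    in r , rooted , λ hit → T-not⁻ not-root (fromWitness (trans hit (sym (proj₂ rooted v))))

  -- The walk from v in attach p (iter p (suc i) v) first meets the cycle after i + 1 steps.
  heightMarked↔acyclicMarked : ∃ (T ∘ heightMarked) ↔ ∃ (T ∘ acyclicMarked)
  heightMarked↔acyclicMarked = mk↔ₛ′ to from to∘from from∘to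
    where
    to : ∃ (T ∘ heightMarked) → ∃ (T ∘ acyclicMarked)
    to ((p , (v , i)) , h) = let _ , rooted , not-root = heightMarked⁻ p v i h in
      (attach p (iter p (suc i) v) , v) ,
      Equivalence.from T-∧ (Attach.connected rooted _ , T-not⁺ (AttachAncestor.acyclic-before rooted v i not-root (s≤s z≤n)))

    from : ∃ (T ∘ acyclicMarked) → ∃ (T ∘ heightMarked)
    from ((g , c) , h) = let i , entry , r , cp = acyclicMarked-entry h in
      (g [ r ]≔ r , (c , i)) ,
      Equivalence.from T-∧
        (isRootedTree⁺ (proj₁ cp) , T-not⁺ λ hit → CutAtEntry.not-root cp entry (trans (toWitness hit) (proj₂ (proj₁ cp) c)))

    to∘from : ∀ y → to (from y) ≡ y
    to∘from ((g , c) , h) = let _ , entry , r , cp = acyclicMarked-entry h in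
      ≡-subtype (cong (_, c) (trans (cong (attach (g [ r ]≔ r)) (CutAtEntry.agrees cp entry ≤-refl)) (attach∘cut cp)))

    from∘to : ∀ x → from (to x) ≡ x
    from∘to x@((p , (v , i)) , h) =
      let _ , rooted , not-root = heightMarked⁻ p v i h
          i′ , entry , _ , cp = acyclicMarked-entry (proj₂ (to x))
          i′≡i = suc-injective (least-unique entry (AttachAncestor.enters-cycle rooted v i not-root))
          c≡w = trans (cong (λ k → iter (attach p (iter p (suc i) v)) (suc k) v) i′≡i)
                      (AttachAncestor.agrees rooted v i not-root ≤-refl)
      in ≡-subtype (cong₂ (λ q i → q , (v , i)) (cut∘attach rooted cp c≡w) i′≡i)

-- Double counting

module Counting (n : ℕ) where

  maps : List (ParentMap n)
  maps = allVecs n n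

  pairs : List (ParentMap n × Fin n)
  pairs = cartesianProduct maps (allFin n)

  triples : List (ParentMap n × (Fin n × ℕ))
  triples = cartesianProduct maps (cartesianProduct (allFin n) (upTo n))

  treeCount recordCount heightSum connectedCount : ℕ
  treeCount      = ∑[ p ∈ maps ] 𝟙 (isRootedTree p)
  recordCount    = ∑[ p ∈ maps ] (𝟙 (isRootedTree p) * nonRootRecords p)
  heightSum      = ∑[ p ∈ maps ] (𝟙 (isRootedTree p) * totalHeight p)
  connectedCount = ∑[ g ∈ maps ] 𝟙 (isConnected g)

  private
    _≟ᵐ_ : DecidableEquality (ParentMap n)
    _≟ᵐ_ = Vec.≡-dec Fin._≟_

    _≟ᵖ_ : DecidableEquality (ParentMap n × Fin n)
    _≟ᵖ_ = ×.≡-dec _≟ᵐ_ Fin._≟_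

    _≟ᵗ_ : DecidableEquality (ParentMap n × (Fin n × ℕ))
    _≟ᵗ_ = ×.≡-dec _≟ᵐ_ (×.≡-dec Fin._≟_ ℕ._≟_)

    maps-once : ∀ p → OccursOnce _≟ᵐ_ maps p
    maps-once = allVecs-once n n

    pairs-once : ∀ x → OccursOnce _≟ᵖ_ pairs x
    pairs-once (p , v) = cartesianProduct-once _≟ᵐ_ Fin._≟_ {maps} {allFin n} {p} {v} (maps-once p) (allFin-once v)

    triples-once : ∀ x → T (heightMarked x) → OccursOnce _≟ᵗ_ triples x
    triples-once (p , (v , i)) h = let _ , rooted , not-root = heightMarked⁻ p v i h in
      cartesianProduct-once _≟ᵐ_ _ {maps} {cartesianProduct (allFin n) (upTo n)} {p} {v , i} (maps-once p)
        (cartesianProduct-once Fin._≟_ ℕ._≟_ {allFin n} {upTo n} {v} {i}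
          (allFin-once v) (upTo-once (≰⇒> (not-root ∘ rooted-iter-≥ rooted v))))

    ∑-pairs : (f : ParentMap n → ℕ) → ∑[ x ∈ pairs ] f (proj₁ x) ≡ ∑ maps f * n
    ∑-pairs f = begin
      ∑[ x ∈ pairs ] f (proj₁ x)                ≡⟨ ∑-cartesianProduct maps (allFin n) (f ∘ proj₁) ⟩
      ∑[ p ∈ maps ] ∑[ v ∈ allFin n ] f p       ≡⟨ ∑-cong maps (λ p → ∑-cong (allFin n) λ _ → *-identityʳ (f p)) ⟨
      ∑[ p ∈ maps ] ∑[ v ∈ allFin n ] (f p * 1) ≡⟨ ∑-*-∑ maps (allFin n) f (λ _ → 1) ⟩
      ∑ maps f * ∑[ v ∈ allFin n ] 1            ≡⟨ cong (∑ maps f *_) (trans (∑-const (allFin n) 1) (+-identityʳ _)) ⟩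
      ∑ maps f * length (allFin n)              ≡⟨ cong (∑ maps f *_) (length-tabulate id) ⟩
      ∑ maps f * n                              ∎
      where open ≡-Reasoning

  recordMarked-count : ∑[ x ∈ pairs ] 𝟙 (recordMarked x) ≡ recordCount + treeCount
  recordMarked-count = begin
    ∑[ x ∈ pairs ] 𝟙 (recordMarked x)                                        ≡⟨ ∑-guarded maps (allFin n) isRootedTree isRecord ⟩
    ∑[ p ∈ maps ] (𝟙 (isRootedTree p) * ∑[ v ∈ allFin n ] 𝟙 (isRecord p v)) ≡⟨ ∑-cong maps per-tree ⟩
    ∑[ p ∈ maps ] (𝟙 (isRootedTree p) * nonRootRecords p + 𝟙 (isRootedTree p)) ≡⟨ ∑-+ maps _ _ ⟩
    recordCount + treeCount                                                  ∎
    where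
    open ≡-Reasoning
    per-tree : ∀ p → let t = 𝟙 (isRootedTree p) in t * ∑[ v ∈ allFin n ] 𝟙 (isRecord p v) ≡ t * nonRootRecords p + t
    per-tree p = let t = 𝟙 (isRootedTree p) in begin
      t * ∑[ v ∈ allFin n ] 𝟙 (isRecord p v) ≡⟨ 𝟙-*-cong (isRootedTree p) (λ tree → records-count (proj₂ (isRootedTree⁻ {p = p} tree))) ⟩
      t * (nonRootRecords p + 1)              ≡⟨ *-distribˡ-+ t (nonRootRecords p) 1 ⟩
      t * nonRootRecords p + t * 1            ≡⟨ cong (t * nonRootRecords p +_) (*-identityʳ t) ⟩
      t * nonRootRecords p + t                ∎

  heightMarked-count : ∑[ x ∈ triples ] 𝟙 (heightMarked x) ≡ heightSum
  heightMarked-count = trans (∑-guarded maps (cartesianProduct (allFin n) (upTo n)) isRootedTree belowRoot)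
                             (∑-cong maps λ p → cong (𝟙 (isRootedTree p) *_) (height-sum p))
    where
    belowRoot : ParentMap n → Fin n × ℕ → Bool
    belowRoot p (v , i) = not (iter p i v == rootFrom p v)
    height-sum : ∀ p → ∑[ y ∈ cartesianProduct (allFin n) (upTo n) ] 𝟙 (belowRoot p y) ≡ totalHeight p
    height-sum p = trans (∑-cartesianProduct (allFin n) (upTo n) (𝟙 ∘ belowRoot p))
                         (∑-cong (allFin n) λ v → sym (length-filterᵇ (λ i → belowRoot p (v , i)) (upTo n)))

  vertexMarked-count : ∑[ x ∈ pairs ] 𝟙 (vertexMarked x) ≡ treeCount * n
  vertexMarked-count = ∑-pairs (𝟙 ∘ isRootedTree)

  acyclic+cyclic-count : ∑[ x ∈ pairs ] 𝟙 (acyclicMarked x) + ∑[ x ∈ pairs ] 𝟙 (cyclicMarked x) ≡ connectedCount * n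
  acyclic+cyclic-count = begin
    ∑[ x ∈ pairs ] 𝟙 (acyclicMarked x) + ∑[ x ∈ pairs ] 𝟙 (cyclicMarked x)
      ≡⟨ ∑-+ pairs (𝟙 ∘ acyclicMarked) (𝟙 ∘ cyclicMarked) ⟨
    ∑[ x ∈ pairs ] (𝟙 (acyclicMarked x) + 𝟙 (cyclicMarked x))
      ≡⟨ ∑-cong pairs (λ (g , c) → 𝟙-∧-not (isConnected g) (isCyclic g c)) ⟩
    ∑[ x ∈ pairs ] 𝟙 (isConnected (proj₁ x))
      ≡⟨ ∑-pairs (𝟙 ∘ isConnected) ⟩
    connectedCount * n ∎
    where open ≡-Reasoning

  records+trees≡connected : recordCount + treeCount ≡ connectedCount
  records+trees≡connected = trans (sym recordMarked-count)
    (count-↔ _≟ᵖ_ _≟ᵐ_ pairs maps recordMarked↔connected (λ x _ → pairs-once x) (λ g _ → maps-once g))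

  heights≡acyclic : heightSum ≡ ∑[ x ∈ pairs ] 𝟙 (acyclicMarked x)
  heights≡acyclic = trans (sym heightMarked-count)
    (count-↔ _≟ᵗ_ _≟ᵖ_ triples pairs heightMarked↔acyclicMarked triples-once (λ x _ → pairs-once x))

  trees*n≡cyclic : treeCount * n ≡ ∑[ x ∈ pairs ] 𝟙 (cyclicMarked x)
  trees*n≡cyclic = trans (sym vertexMarked-count)
    (count-↔ _≟ᵖ_ _≟ᵖ_ pairs pairs vertexMarked↔cyclicMarked (λ x _ → pairs-once x) (λ x _ → pairs-once x))

  records*n≡heights : recordCount * n ≡ heightSum
  records*n≡heights = +-cancelʳ-≡ (treeCount * n) _ _ (begin
    recordCount * n + treeCount * n
      ≡⟨ *-distribʳ-+ n recordCount treeCount ⟨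
    (recordCount + treeCount) * n
      ≡⟨ cong (_* n) records+trees≡connected ⟩
    connectedCount * n
      ≡⟨ acyclic+cyclic-count ⟨
    ∑[ x ∈ pairs ] 𝟙 (acyclicMarked x) + ∑[ x ∈ pairs ] 𝟙 (cyclicMarked x)
      ≡⟨ cong₂ _+_ heights≡acyclic trees*n≡cyclic ⟨
    heightSum + treeCount * n ∎)
    where open ≡-Reasoning

theorem2p2 : (n : ℕ) → 1 ≤ n →
    n * sum (map nonRootRecords (rootedTrees n)) ≡ sum (map totalHeight (rootedTrees n))
theorem2p2 n _ = begin
  n * sum (map nonRootRecords (rootedTrees n)) ≡⟨ cong (n *_) (∑-filterᵇ isRootedTree maps nonRootRecords) ⟩
  n * recordCount                              ≡⟨ *-comm n recordCount ⟩
  recordCount * n                              ≡⟨ records*n≡heights ⟩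
  heightSum                                    ≡⟨ ∑-filterᵇ isRootedTree maps totalHeight ⟨
  sum (map totalHeight (rootedTrees n))        ∎
  where
  open ≡-Reasoning
  open Counting n
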